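{- Let $\mathcal{G}$ be a finite, simple, connected undirected graph with vertex set $V$, $b_0\in V$, and $f$ a weight function as below. If $G_i$ and $G_j$ are facet graphs of $\mathcal{G}$ with $f(G_i)<f(G_j)$, then there exists a partition $V=V_0\sqcup V_1$ into nonempty parts with $b_0\in V_0$ such that every edge of $G_j$ between $V_0$ and $V_1$ points from $V_1$ to $V_0$, and every edge of $G_i$ between $V_0$ and $V_1$ points from $V_0$ to $V_1$.
   Context: A layering is $l:V\to\mathbb{Z}$ with $|l(u)-l(v)|\le1$ for every edge $uv$ of $\mathcal{G}$ such that the edges $E_l=\{uv:|l(u)-l(v)|=1\}$ form a connected spanning subgraph of $\mathcal{G}$. Its facet graph is the digraph $(V,E_l)$ where $uv$ is oriented from $u$ to $v$ when $l(v)-l(u)=1$. Layerings differing by a constant give the same facet graph. Weight function: $f:V\to\mathbb{R}$ with $f(b_0)=1$, $-1\le f(v)\le 0$ for $v\ne b_0$, $\sum_{v\ne b_0}f(v)=-1$, and $\{f(v):v\ne b_0\}$ linearly independent over $\mathbb{Z}$. For a facet graph $G$ with layering $l$, $f(G)=\sum_{v\in V}l(v)f(v)$ (well defined since $\sum_v f(v)=0$). -}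

module Defs where

open import Level using (Level; _⊔_) renaming (suc to lsuc)
open import Data.Nat using (ℕ; zero; suc)
open import Data.Integer using (ℤ; +_; -[1+_]; ∣_∣) renaming (_-_ to _-ℤ_; _+_ to _+ℤ_)
open import Data.Fin using (Fin; _≟_) renaming (zero to fzero; suc to fsuc)
open import Data.Bool using (Bool; true; false)
open import Data.Product using (Σ; _×_; _,_; ∃)
open import Relation.Nullary using (¬_; yes; no)
open import Relation.Binary using (Rel; IsTotalOrder)
open import Relation.Binary.PropositionalEquality using (_≡_; _≢_)
open import Relation.Binary.Construct.Closure.ReflexiveTransitive using (Star)
open import Algebra.Bundles using (CommutativeRing)

record SimpleGraph (n : ℕ) : Set₁ where
  field
    Adj     : Fin n → Fin n → Set
    sym     : ∀ {u v} → Adj u v → Adj v u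
    irrefl  : ∀ {u} → ¬ Adj u u

Connected : ∀ {n} → SimpleGraph n → Set
Connected 𝒢 = ∀ u v → Star (SimpleGraph.Adj 𝒢) u v

module _ {n : ℕ} (𝒢 : SimpleGraph n) where
  open SimpleGraph 𝒢

  LayerEdge : (Fin n → ℤ) → Fin n → Fin n → Set
  LayerEdge l u v = Adj u v × ∣ l u -ℤ l v ∣ ≡ 1

  FacetArc : (Fin n → ℤ) → Fin n → Fin n → Set
  FacetArc l u v = Adj u v × l v ≡ l u +ℤ + 1

  record Layering : Set₁ where
    field
      l        : Fin n → ℤ
      lipschitz : ∀ {u v} → Adj u v → Data.Nat._≤_ ∣ l u -ℤ l v ∣ 1
      spanning-connected : ∀ u v → Star (LayerEdge l) u v

-- Totally ordered commutative rings (stand-in for ℝ)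

record OrderedCommRing (c ℓ₁ ℓ₂ : Level) : Set (lsuc (c ⊔ ℓ₁ ⊔ ℓ₂)) where
  field
    commutativeRing : CommutativeRing c ℓ₁
  open CommutativeRing commutativeRing public
  field
    _≤_          : Rel Carrier ℓ₂
    isTotalOrder : IsTotalOrder _≈_ _≤_
    +-mono-≤     : ∀ {x y} z → x ≤ y → (x + z) ≤ (y + z)
    *-nonneg     : ∀ {x y} → 0# ≤ x → 0# ≤ y → 0# ≤ (x * y)
    nontrivial   : ¬ (1# ≈ 0#)

  _<_ : Rel Carrier (ℓ₁ ⊔ ℓ₂)
  x < y = (x ≤ y) × ¬ (x ≈ y)

  _·ℕ_ : ℕ → Carrier → Carrier
  zero  ·ℕ x = 0#
  suc k ·ℕ x = x + (k ·ℕ x)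

  _·ℤ_ : ℤ → Carrier → Carrier
  (+ k)    ·ℤ x = k ·ℕ x
  -[1+ k ] ·ℤ x = - (suc k ·ℕ x)

  Σᵥ : ∀ {n} → (Fin n → Carrier) → Carrier
  Σᵥ {zero}  g = 0#
  Σᵥ {suc n} g = g fzero + Σᵥ (λ i → g (fsuc i))

  Σ≠ : ∀ {n} → Fin n → (Fin n → Carrier) → Carrier
  Σ≠ b₀ g = Σᵥ (λ v → h v (v ≟ b₀))
    where
      h : ∀ v → Relation.Nullary.Dec (v ≡ b₀) → Carrier
      h v (yes _) = 0#
      h v (no _)  = g v

  record WeightFunction {n : ℕ} (b₀ : Fin n) : Set (c ⊔ ℓ₁ ⊔ ℓ₂) where
    field
      f        : Fin n → Carrier
      f-b₀     : f b₀ ≈ 1#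
      f-lower  : ∀ v → v ≢ b₀ → (- 1#) ≤ f v
      f-upper  : ∀ v → v ≢ b₀ → f v ≤ 0#
      f-sum    : Σ≠ b₀ f ≈ (- 1#)
      f-indep  : ∀ (coef : Fin n → ℤ) →
                 Σ≠ b₀ (λ v → coef v ·ℤ f v) ≈ 0# →
                 ∀ v → v ≢ b₀ → coef v ≡ + 0

  -- f(G) = Σ_v l(v) f(v) for the facet graph G of the layering l
  weight : ∀ {n} → (Fin n → Carrier) → (Fin n → ℤ) → Carrier
  weight f l = Σᵥ (λ v → l v ·ℤ f v)

{-# OPTIONS --safe #-}
-- Let gap = lⱼ − lᵢ and V₁ = {v | gap v < gap b₀}. For an edge uv with u ∈ V₀
-- and v ∈ V₁ we have gap v < gap u, so the step lⱼ u − lⱼ v exceeds lᵢ u − lᵢ v;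
-- both lie in {−1, 0, 1}, hence a unit step of lⱼ is +1 (arc v → u) and a unit
-- step of lᵢ is −1 (arc u → v). V₁ is nonempty: otherwise lⱼ = lᵢ + gap b₀ + e
-- with e ≥ 0 and e b₀ = 0, and as Σ f = 0 while f ≤ 0 off b₀, this would give
-- f(Gⱼ) = f(Gᵢ) + Σ e f ≤ f(Gᵢ).
module Submission where

open import Defs
open import Level using (Level)
open import Function using (_∘_)
open import Data.Nat as ℕ using (ℕ; zero; suc; s≤s)
import Data.Nat.Properties as ℕ
open import Data.Fin using (Fin; _≟_) renaming (zero to fzero; suc to fsuc)
open import Data.Fin.Properties using (any?; punchInᵢ≢i)
open import Data.Vec.Functional using (removeAt)
open import Data.Bool using (Bool; true; false)
open import Data.Product using (Σ; ∃; _×_; _,_; map₂)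
open import Data.Integer as ℤ using (ℤ; +_; -[1+_]; ∣_∣; _⊖_; +<+)
  renaming (_+_ to _+ℤ_; _-_ to _-ℤ_; _<_ to _<ℤ_; _≤_ to _≤ℤ_)
import Data.Integer.Properties as ℤ
open import Data.Integer.Tactic.RingSolver using (solve-∀)
open import Data.Empty using (⊥-elim)
open import Relation.Nullary using (Dec; yes; no; does; ¬_)
open import Relation.Nullary.Decidable using (dec-true; dec-false)
open import Relation.Binary.Bundles using (Poset)
open import Relation.Binary.Structures using (IsTotalOrder)
open import Relation.Binary.PropositionalEquality as ≡ using (_≡_; _≢_)
import Relation.Binary.Reasoning.Setoid as SetoidReasoning
import Relation.Binary.Reasoning.PartialOrder as PosetReasoning
import Algebra.Properties.CommutativeMonoid.Sum as CommutativeMonoidSum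
import Algebra.Properties.CommutativeSemigroup as CommutativeSemigroupProperties
import Algebra.Properties.AbelianGroup as AbelianGroupProperties
import Algebra.Properties.Group as GroupProperties

dec-true⁻¹ : ∀ {a} {A : Set a} (a? : Dec A) → does a? ≡ true → A
dec-true⁻¹ (yes a) _ = a

dec-false⁻¹ : ∀ {a} {A : Set a} (a? : Dec A) → does a? ≡ false → ¬ A
dec-false⁻¹ (no ¬a) _ = ¬a

unit>⇒≡1 : ∀ {a b} → ∣ b ∣ ℕ.≤ 1 → b <ℤ a → ∣ a ∣ ≡ 1 → a ≡ + 1
unit>⇒≡1 {+ 1}                          _        _   _  = ≡.refl
unit>⇒≡1 { -[1+ 0 ]} { -[1+ 0 ]}        _        b<a _  = ⊥-elim (ℤ.<-irrefl ≡.refl b<a)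
unit>⇒≡1 { -[1+ 0 ]} { -[1+ suc _ ]}    (s≤s ()) _   _
unit>⇒≡1 { -[1+ 0 ]} {+ _}              _        ()  _
unit>⇒≡1 {+ 0}                          _        _   ()
unit>⇒≡1 {+ suc (suc _)}                _        _   ()
unit>⇒≡1 { -[1+ suc _ ]}                _        _   ()

unit<⇒≡-1 : ∀ {a b} → ∣ a ∣ ℕ.≤ 1 → b <ℤ a → ∣ b ∣ ≡ 1 → b ≡ -[1+ 0 ]
unit<⇒≡-1 {b = -[1+ 0 ]}                _        _        _  = ≡.refl
unit<⇒≡-1 {+ 1}           {+ 1}         _        b<a      _  = ⊥-elim (ℤ.<-irrefl ≡.refl b<a)
unit<⇒≡-1 {+ suc (suc _)} {+ 1}         (s≤s ()) _        _
unit<⇒≡-1 {+ 0}           {+ 1}         _        (+<+ ()) _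
unit<⇒≡-1 { -[1+ _ ]}     {+ 1}         _        ()       _
unit<⇒≡-1 {b = + 0}                     _        _        ()
unit<⇒≡-1 {b = + suc (suc _)}           _        _        ()
unit<⇒≡-1 {b = -[1+ suc _ ]}            _        _        ()

x-y≡1⇒x≡y+1 : ∀ x y → x -ℤ y ≡ + 1 → x ≡ y +ℤ + 1
x-y≡1⇒x≡y+1 x y eq = ≡.trans (split x y) (≡.cong (y +ℤ_) eq)
  where
  split : ∀ x y → x ≡ y +ℤ (x -ℤ y)
  split = solve-∀

x-y≡-1⇒y≡x+1 : ∀ x y → x -ℤ y ≡ -[1+ 0 ] → y ≡ x +ℤ + 1
x-y≡-1⇒y≡x+1 x y eq = ≡.trans (split x y) (≡.cong (x -ℤ_) eq)
  where
  split : ∀ x y → y ≡ x -ℤ (x -ℤ y)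
  split = solve-∀

gap : ∀ {n} → (Fin n → ℤ) → (Fin n → ℤ) → Fin n → ℤ
gap l l′ v = l v -ℤ l′ v

gap<⇒step< : ∀ {n} (l l′ : Fin n → ℤ) u v →
  gap l l′ v <ℤ gap l l′ u → l′ u -ℤ l′ v <ℤ l u -ℤ l v
gap<⇒step< l l′ u v gap< =
  ≡.subst₂ _<ℤ_ (lhs (l v) (l′ v) (l′ u)) (rhs (l u) (l v) (l′ u)) (ℤ.+-monoˡ-< (l′ u -ℤ l v) gap<)
  where
  lhs : ∀ y y′ x′ → (y -ℤ y′) +ℤ (x′ -ℤ y) ≡ x′ -ℤ y′
  lhs = solve-∀
  rhs : ∀ x y x′ → (x -ℤ x′) +ℤ (x′ -ℤ y) ≡ x -ℤ y
  rhs = solve-∀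

gap-decomposition : ∀ {n} (l l′ : Fin n → ℤ) b₀ v →
  l v ≡ l′ v +ℤ (gap l l′ b₀ +ℤ (gap l l′ v -ℤ gap l l′ b₀))
gap-decomposition l l′ b₀ v = identity (l v) (l′ v) (gap l l′ b₀)
  where
  identity : ∀ x x′ c → x ≡ x′ +ℤ (c +ℤ ((x -ℤ x′) -ℤ c))
  identity = solve-∀

module WeightProperties {c ℓ₁ ℓ₂ : Level} (R : OrderedCommRing c ℓ₁ ℓ₂) where
  open OrderedCommRing R
  open CommutativeMonoidSum +-commutativeMonoid using (sum; sum-remove; sum-cong-≋; ∑-distrib-+)
  open CommutativeSemigroupProperties +-commutativeSemigroup using (interchange)
  open AbelianGroupProperties +-abelianGroup using (⁻¹-∙-comm)
  open GroupProperties +-group using (ε⁻¹≈ε)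

  module ≈-Reasoning = SetoidReasoning setoid

  poset : Poset c ℓ₁ ℓ₂
  poset = record { isPartialOrder = IsTotalOrder.isPartialOrder isTotalOrder }

  module ≤-Reasoning = PosetReasoning poset
  open IsTotalOrder isTotalOrder using (antisym)
    renaming (reflexive to ≤-reflexive)

  ·ℕ-congʳ : ∀ k {x y} → x ≈ y → k ·ℕ x ≈ k ·ℕ y
  ·ℕ-congʳ zero    x≈y = refl
  ·ℕ-congʳ (suc k) x≈y = +-cong x≈y (·ℕ-congʳ k x≈y)

  ·ℕ-homo-+ : ∀ m n x → (m ℕ.+ n) ·ℕ x ≈ m ·ℕ x + n ·ℕ x
  ·ℕ-homo-+ zero    n x = sym (+-identityˡ _)
  ·ℕ-homo-+ (suc m) n x = trans (+-congˡ (·ℕ-homo-+ m n x)) (sym (+-assoc _ _ _))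

  ·ℕ-distrib-+ : ∀ k x y → k ·ℕ (x + y) ≈ k ·ℕ x + k ·ℕ y
  ·ℕ-distrib-+ zero    x y = sym (+-identityˡ 0#)
  ·ℕ-distrib-+ (suc k) x y = trans (+-congˡ (·ℕ-distrib-+ k x y)) (interchange _ _ _ _)

  ·ℕ-zeroʳ : ∀ k → k ·ℕ 0# ≈ 0#
  ·ℕ-zeroʳ zero    = refl
  ·ℕ-zeroʳ (suc k) = trans (+-identityˡ _) (·ℕ-zeroʳ k)

  ·ℤ-congʳ : ∀ k {x y} → x ≈ y → k ·ℤ x ≈ k ·ℤ y
  ·ℤ-congʳ (+ k)    x≈y = ·ℕ-congʳ k x≈y
  ·ℤ-congʳ -[1+ k ] x≈y = -‿cong (·ℕ-congʳ (suc k) x≈y)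

  -‿distrib-+ : ∀ x y → - (x + y) ≈ - x + - y
  -‿distrib-+ x y = sym (⁻¹-∙-comm x y)

  ⊖-·ℤ : ∀ m n x → (m ⊖ n) ·ℤ x ≈ m ·ℕ x - n ·ℕ x
  ⊖-·ℤ zero    zero    x = sym (-‿inverseʳ 0#)
  ⊖-·ℤ zero    (suc n) x = sym (+-identityˡ _)
  ⊖-·ℤ (suc m) zero    x = sym (trans (+-congˡ ε⁻¹≈ε) (+-identityʳ _))
  ⊖-·ℤ (suc m) (suc n) x = begin
    (suc m ⊖ suc n) ·ℤ x                ≡⟨ ≡.cong (_·ℤ x) (ℤ.[1+m]⊖[1+n]≡m⊖n m n) ⟩
    (m ⊖ n) ·ℤ x                        ≈⟨ ⊖-·ℤ m n x ⟩
    m ·ℕ x - n ·ℕ x                     ≈⟨ +-identityˡ _ ⟨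
    0# + (m ·ℕ x - n ·ℕ x)              ≈⟨ +-congʳ (-‿inverseʳ x) ⟨
    (x - x) + (m ·ℕ x - n ·ℕ x)         ≈⟨ interchange _ _ _ _ ⟩
    (x + m ·ℕ x) + (- x + - (n ·ℕ x))   ≈⟨ +-congˡ (-‿distrib-+ x (n ·ℕ x)) ⟨
    (x + m ·ℕ x) - (x + n ·ℕ x)         ∎
    where open ≈-Reasoning

  ·ℤ-homo-+ : ∀ a b x → (a +ℤ b) ·ℤ x ≈ a ·ℤ x + b ·ℤ x
  ·ℤ-homo-+ (+ m)    (+ n)    x = ·ℕ-homo-+ m n x
  ·ℤ-homo-+ (+ m)    -[1+ n ] x = ⊖-·ℤ m (suc n) x
  ·ℤ-homo-+ -[1+ m ] (+ n)    x = trans (⊖-·ℤ n (suc m) x) (+-comm _ _)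
  ·ℤ-homo-+ -[1+ m ] -[1+ n ] x = begin
    - (suc (suc (m ℕ.+ n)) ·ℕ x)          ≡⟨ ≡.cong (λ k → - (suc k ·ℕ x)) (ℕ.+-suc m n) ⟨
    - ((suc m ℕ.+ suc n) ·ℕ x)            ≈⟨ -‿cong (·ℕ-homo-+ (suc m) (suc n) x) ⟩
    - (suc m ·ℕ x + suc n ·ℕ x)           ≈⟨ -‿distrib-+ _ _ ⟩
    - (suc m ·ℕ x) + - (suc n ·ℕ x)       ∎
    where open ≈-Reasoning

  ·ℤ-distrib-+ : ∀ k x y → k ·ℤ (x + y) ≈ k ·ℤ x + k ·ℤ y
  ·ℤ-distrib-+ (+ k)    x y = ·ℕ-distrib-+ k x y
  ·ℤ-distrib-+ -[1+ k ] x y = trans (-‿cong (·ℕ-distrib-+ (suc k) x y)) (-‿distrib-+ _ _)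

  ·ℤ-zeroʳ : ∀ k → k ·ℤ 0# ≈ 0#
  ·ℤ-zeroʳ (+ k)    = ·ℕ-zeroʳ k
  ·ℤ-zeroʳ -[1+ k ] = trans (-‿cong (·ℕ-zeroʳ (suc k))) ε⁻¹≈ε

  Σᵥ≡sum : ∀ {n} (g : Fin n → Carrier) → Σᵥ g ≡ sum g
  Σᵥ≡sum {zero}  g = ≡.refl
  Σᵥ≡sum {suc n} g = ≡.cong (λ s → g fzero + s) (Σᵥ≡sum (g ∘ fsuc))

  Σᵥ-cong : ∀ {n} {g h : Fin n → Carrier} → (∀ v → g v ≈ h v) → Σᵥ g ≈ Σᵥ h
  Σᵥ-cong {g = g} {h} g≈h = begin
    Σᵥ g    ≡⟨ Σᵥ≡sum g ⟩
    sum g   ≈⟨ sum-cong-≋ g≈h ⟩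
    sum h   ≡⟨ Σᵥ≡sum h ⟨
    Σᵥ h    ∎
    where open ≈-Reasoning

  Σᵥ-distrib-+ : ∀ {n} (g h : Fin n → Carrier) → Σᵥ (λ v → g v + h v) ≈ Σᵥ g + Σᵥ h
  Σᵥ-distrib-+ g h = begin
    Σᵥ (λ v → g v + h v)    ≡⟨ Σᵥ≡sum (λ v → g v + h v) ⟩
    sum (λ v → g v + h v)   ≈⟨ ∑-distrib-+ g h ⟩
    sum g + sum h           ≡⟨ ≡.cong₂ _+_ (Σᵥ≡sum g) (Σᵥ≡sum h) ⟨
    Σᵥ g + Σᵥ h             ∎
    where open ≈-Reasoning

  Σᵥ-split : ∀ {n} (b₀ : Fin n) (g h : Fin n → Carrier) →
    h b₀ ≈ 0# → (∀ v → v ≢ b₀ → h v ≈ g v) → Σᵥ g ≈ g b₀ + Σᵥ h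
  Σᵥ-split {suc n} b₀ g h hb₀≈0 h≈g = begin
    Σᵥ g                                  ≡⟨ Σᵥ≡sum g ⟩
    sum g                                 ≈⟨ sum-remove g ⟩
    g b₀ + sum (removeAt g b₀)            ≈⟨ +-congˡ (sum-cong-≋ λ i → h≈g _ (punchInᵢ≢i b₀ i)) ⟨
    g b₀ + sum (removeAt h b₀)            ≈⟨ +-congˡ (+-identityˡ _) ⟨
    g b₀ + (0# + sum (removeAt h b₀))     ≈⟨ +-congˡ (+-congʳ hb₀≈0) ⟨
    g b₀ + (h b₀ + sum (removeAt h b₀))   ≈⟨ +-congˡ (sum-remove h) ⟨
    g b₀ + sum h                          ≡⟨ ≡.cong (λ s → g b₀ + s) (Σᵥ≡sum h) ⟨
    g b₀ + Σᵥ h                           ∎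
    where open ≈-Reasoning

  ·ℤ-distrib-Σᵥ : ∀ {n} k (g : Fin n → Carrier) → k ·ℤ Σᵥ g ≈ Σᵥ (λ v → k ·ℤ g v)
  ·ℤ-distrib-Σᵥ {zero}  k g = ·ℤ-zeroʳ k
  ·ℤ-distrib-Σᵥ {suc n} k g =
    trans (·ℤ-distrib-+ k _ _) (+-congˡ (·ℤ-distrib-Σᵥ k (g ∘ fsuc)))

  -- The summand of Σ≠ is a where-local case split on v ≟ b₀, which cannot be
  -- referred to by name; unification against Σ≠ recovers it.
  mutual
    Σ≠-summand : ∀ {n} → Fin n → (Fin n → Carrier) → Fin n → Carrier
    Σ≠-summand = _

    Σ≠-unfold : ∀ {n} (b₀ : Fin n) g → Σ≠ b₀ g ≡ Σᵥ (Σ≠-summand b₀ g)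
    Σ≠-unfold b₀ g = ≡.refl

  Σᵥ-split-Σ≠ : ∀ {n} (b₀ : Fin n) (g : Fin n → Carrier) → Σᵥ g ≈ g b₀ + Σ≠ b₀ g
  Σᵥ-split-Σ≠ b₀ g = ≡.subst (λ s → Σᵥ g ≈ g b₀ + s) (≡.sym (Σ≠-unfold b₀ g))
    (Σᵥ-split b₀ g (Σ≠-summand b₀ g) summand-b₀ summand-off)
    where
    summand-b₀ : Σ≠-summand b₀ g b₀ ≈ 0#
    summand-b₀ with b₀ ≟ b₀
    ... | yes _   = refl
    ... | no b₀≢b₀ = ⊥-elim (b₀≢b₀ ≡.refl)
    summand-off : ∀ v → v ≢ b₀ → Σ≠-summand b₀ g v ≈ g v
    summand-off v v≢b₀ with v ≟ b₀
    ... | yes v≡b₀ = ⊥-elim (v≢b₀ v≡b₀)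
    ... | no _     = refl

  Σᵥ-weight≈0 : ∀ {n} {b₀ : Fin n} (w : WeightFunction b₀) → Σᵥ (WeightFunction.f w) ≈ 0#
  Σᵥ-weight≈0 {b₀ = b₀} w = begin
    Σᵥ f            ≈⟨ Σᵥ-split-Σ≠ b₀ f ⟩
    f b₀ + Σ≠ b₀ f  ≈⟨ +-cong f-b₀ f-sum ⟩
    1# - 1#         ≈⟨ -‿inverseʳ 1# ⟩
    0#              ∎
    where open WeightFunction w
          open ≈-Reasoning

  +-nonpos : ∀ {x y} → x ≤ 0# → y ≤ 0# → (x + y) ≤ 0#
  +-nonpos {x} {y} x≤0 y≤0 = begin
    x + y   ≤⟨ +-mono-≤ y x≤0 ⟩
    0# + y  ≈⟨ +-identityˡ y ⟩
    y       ≤⟨ y≤0 ⟩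
    0#      ∎
    where open ≤-Reasoning

  +-nonpos-≤ : ∀ x {y} → y ≤ 0# → (x + y) ≤ x
  +-nonpos-≤ x {y} y≤0 = begin
    x + y   ≈⟨ +-comm x y ⟩
    y + x   ≤⟨ +-mono-≤ x y≤0 ⟩
    0# + x  ≈⟨ +-identityˡ x ⟩
    x       ∎
    where open ≤-Reasoning

  ·ℕ-nonpos : ∀ k {x} → x ≤ 0# → (k ·ℕ x) ≤ 0#
  ·ℕ-nonpos zero    x≤0 = ≤-reflexive refl
  ·ℕ-nonpos (suc k) x≤0 = +-nonpos x≤0 (·ℕ-nonpos k x≤0)

  ·ℤ-nonpos : ∀ {k x} → + 0 ≤ℤ k → x ≤ 0# → (k ·ℤ x) ≤ 0#
  ·ℤ-nonpos {+ k} _ = ·ℕ-nonpos k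

  Σᵥ-nonpos : ∀ {n} (g : Fin n → Carrier) → (∀ v → g v ≤ 0#) → Σᵥ g ≤ 0#
  Σᵥ-nonpos {zero}  g g≤0 = ≤-reflexive refl
  Σᵥ-nonpos {suc n} g g≤0 = +-nonpos (g≤0 fzero) (Σᵥ-nonpos (g ∘ fsuc) (g≤0 ∘ fsuc))

  module _ {n} (f : Fin n → Carrier) where

    weight-cong : ∀ {l l′} → (∀ v → l v ≡ l′ v) → weight f l ≈ weight f l′
    weight-cong l≗l′ = Σᵥ-cong λ v → reflexive (≡.cong (_·ℤ f v) (l≗l′ v))

    weight-+ : ∀ l m → weight f (λ v → l v +ℤ m v) ≈ weight f l + weight f m
    weight-+ l m = trans (Σᵥ-cong λ v → ·ℤ-homo-+ (l v) (m v) (f v))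
                         (Σᵥ-distrib-+ (λ v → l v ·ℤ f v) (λ v → m v ·ℤ f v))

    weight-const : Σᵥ f ≈ 0# → ∀ k → weight f (λ _ → k) ≈ 0#
    weight-const Σf≈0 k = begin
      Σᵥ (λ v → k ·ℤ f v)  ≈⟨ ·ℤ-distrib-Σᵥ k f ⟨
      k ·ℤ Σᵥ f            ≈⟨ ·ℤ-congʳ k Σf≈0 ⟩
      k ·ℤ 0#              ≈⟨ ·ℤ-zeroʳ k ⟩
      0#                   ∎
      where open ≈-Reasoning

    weight-nonpos : (b₀ : Fin n) → (∀ v → v ≢ b₀ → f v ≤ 0#) →
      ∀ e → (∀ v → + 0 ≤ℤ e v) → e b₀ ≡ + 0 → weight f e ≤ 0#
    weight-nonpos b₀ f≤0 e e≥0 eb₀≡0 = Σᵥ-nonpos _ term≤0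
      where
      term≤0 : ∀ v → (e v ·ℤ f v) ≤ 0#
      term≤0 v with v ≟ b₀
      ... | yes ≡.refl = ≤-reflexive (reflexive (≡.cong (_·ℤ f v) eb₀≡0))
      ... | no v≢b₀    = ·ℤ-nonpos (e≥0 v) (f≤0 v v≢b₀)

    module _ (b₀ : Fin n) (Σf≈0 : Σᵥ f ≈ 0#) (f≤0 : ∀ v → v ≢ b₀ → f v ≤ 0#) where

      weight-≤-if-gap-minimal-at-base : ∀ l l′ → (∀ v → gap l′ l b₀ ≤ℤ gap l′ l v) →
        weight f l′ ≤ weight f l
      weight-≤-if-gap-minimal-at-base l l′ gap-min = begin
        weight f l′                                 ≈⟨ weight-cong (gap-decomposition l′ l b₀) ⟩
        weight f (λ v → l v +ℤ (δ₀ +ℤ e v))          ≈⟨ weight-+ l _ ⟩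
        weight f l + weight f (λ v → δ₀ +ℤ e v)      ≈⟨ +-congˡ (weight-+ (λ _ → δ₀) e) ⟩
        weight f l + (weight f (λ _ → δ₀) + weight f e) ≈⟨ +-congˡ (+-congʳ (weight-const Σf≈0 δ₀)) ⟩
        weight f l + (0# + weight f e)              ≈⟨ +-congˡ (+-identityˡ _) ⟩
        weight f l + weight f e                     ≤⟨ +-nonpos-≤ _ (weight-nonpos b₀ f≤0 e e≥0 (ℤ.+-inverseʳ δ₀)) ⟩
        weight f l                                  ∎
        where
        open ≤-Reasoning
        δ₀ : ℤ
        δ₀ = gap l′ l b₀
        e : Fin n → ℤ
        e v = gap l′ l v -ℤ δ₀
        e≥0 : ∀ v → + 0 ≤ℤ e v
        e≥0 v = ℤ.i≤j⇒0≤j-i (gap-min v)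

      gap-drops-below-base : ∀ l l′ → weight f l < weight f l′ → ∃ λ v → gap l′ l v <ℤ gap l′ l b₀
      gap-drops-below-base l l′ (wl≤wl′ , wl≉wl′) with any? (λ v → gap l′ l v ℤ.<? gap l′ l b₀)
      ... | yes drop = drop
      ... | no ∄drop = ⊥-elim (wl≉wl′ (antisym wl≤wl′
                         (weight-≤-if-gap-minimal-at-base l l′ λ v → ℤ.≮⇒≥ (∄drop ∘ (v ,_)))))

module Cut {n} (𝒢 : SimpleGraph n) (L L′ : Layering 𝒢) (b₀ : Fin n) where
  open SimpleGraph 𝒢 using () renaming (sym to Adj-sym)
  open Layering L using (l)
  open Layering L′ using () renaming (l to l′)

  inV₁ : Fin n → Bool
  inV₁ v = does (gap l l′ v ℤ.<? gap l l′ b₀)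

  below-base⇒∈V₁ : ∀ {v} → gap l l′ v <ℤ gap l l′ b₀ → inV₁ v ≡ true
  below-base⇒∈V₁ {v} = dec-true (gap l l′ v ℤ.<? gap l l′ b₀)

  b₀∉V₁ : inV₁ b₀ ≡ false
  b₀∉V₁ = dec-false (gap l l′ b₀ ℤ.<? gap l l′ b₀) (ℤ.<-irrefl ≡.refl)

  cut-orientation : ∀ u v → inV₁ u ≡ false → inV₁ v ≡ true →
    (LayerEdge 𝒢 l u v → FacetArc 𝒢 l v u) × (LayerEdge 𝒢 l′ u v → FacetArc 𝒢 l′ u v)
  cut-orientation u v u∈V₀ v∈V₁ =
    (λ (uv , ∣Δl∣≡1) → Adj-sym uv ,
       x-y≡1⇒x≡y+1 (l u) (l v) (unit>⇒≡1 (Layering.lipschitz L′ uv) Δl′<Δl ∣Δl∣≡1)) ,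
    (λ (uv , ∣Δl′∣≡1) → uv ,
       x-y≡-1⇒y≡x+1 (l′ u) (l′ v) (unit<⇒≡-1 (Layering.lipschitz L uv) Δl′<Δl ∣Δl′∣≡1))
    where
    gapv<gapu : gap l l′ v <ℤ gap l l′ u
    gapv<gapu = ℤ.<-≤-trans (dec-true⁻¹ (gap l l′ v ℤ.<? gap l l′ b₀) v∈V₁)
                            (ℤ.≮⇒≥ (dec-false⁻¹ (gap l l′ u ℤ.<? gap l l′ b₀) u∈V₀))
    Δl′<Δl : l′ u -ℤ l′ v <ℤ l u -ℤ l v
    Δl′<Δl = gap<⇒step< l l′ u v gapv<gapu

lemma3p6 : ∀ {c ℓ₁ ℓ₂ : Level} (R : OrderedCommRing c ℓ₁ ℓ₂)
  {n : ℕ} (𝒢 : SimpleGraph n) → Connected 𝒢 →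
  (b₀ : Fin n) (w : OrderedCommRing.WeightFunction R b₀) →
  (Gᵢ Gⱼ : Layering 𝒢) →
  OrderedCommRing._<_ R
    (OrderedCommRing.weight R (OrderedCommRing.WeightFunction.f w) (Layering.l Gᵢ))
    (OrderedCommRing.weight R (OrderedCommRing.WeightFunction.f w) (Layering.l Gⱼ)) →
  -- inV₁ v ≡ true  means v ∈ V₁, false means v ∈ V₀
  Σ (Fin n → Bool) λ inV₁ →
    (inV₁ b₀ ≡ false) ×
    (∃ λ v → inV₁ v ≡ true) ×
    (∀ u v → inV₁ u ≡ false → inV₁ v ≡ true →
      (LayerEdge 𝒢 (Layering.l Gⱼ) u v → FacetArc 𝒢 (Layering.l Gⱼ) v u) ×
      (LayerEdge 𝒢 (Layering.l Gᵢ) u v → FacetArc 𝒢 (Layering.l Gᵢ) u v))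
lemma3p6 R 𝒢 _ b₀ w Gᵢ Gⱼ wᵢ<wⱼ =
    inV₁
  , b₀∉V₁
  , map₂ below-base⇒∈V₁
      (gap-drops-below-base f b₀ (Σᵥ-weight≈0 w) f-upper (Layering.l Gᵢ) (Layering.l Gⱼ) wᵢ<wⱼ)
  , cut-orientation
  where
  open Cut 𝒢 Gⱼ Gᵢ b₀
  open OrderedCommRing.WeightFunction w
  open WeightProperties R using (Σᵥ-weight≈0; gap-drops-below-base)
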